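{- Let $G=(V,E)$ be a directed graph on $n$ vertices whose underlying undirected graph has diameter $1$. For every two different vertices $x,y\in V$, if $y$ is reachable from $x$ in $G$, then there exists an index $i\in\{0,\dots,n-1\}$ such that $f_i[x]\ne\perp$ and $f_i[x]\ge d_{out}(y)$. Moreover, if $i$ is the minimal index with this property, then the distance from $x$ to $y$ in $G$ is at least $i+1$.
   Context: Directed graphs are simple (anti-parallel edges allowed); underlying diameter $1$ means between every two distinct vertices at least one directed edge is present. $N_{out}(x)$ is the set of out-neighbours of $x$, $d_{out}$ the out-degree; distance is the number of edges of a shortest directed path. For each integer $0\le i<n$, let $A(i)=\{u\in V: d_{out}(u)>i \text{ and there is } w\in V \text{ with } (w,u)\in E \text{ and } d_{out}(w)\le i\}$, and let $M(i)=\perp$ if $A(i)=\varnothing$ and $M(i)=\max\{d_{out}(v): v\in A(i)\}$ otherwise. For each $x\in V$ define $f_0[x]=\max\{d_{out}(v): v\in\{x\}\cup N_{out}(x)\}$, and for $k\in\{1,\dots,n\}$ let $f_k[x]=\perp$ if $f_{k-1}[x]=\perp$ and $f_k[x]=M(f_{k-1}[x])$ otherwise. -}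

module Defs where

open import Data.Nat using (ℕ; zero; suc; _+_; _≤_; _<_; _<ᵇ_; _≤ᵇ_; _⊔_)
open import Data.Bool using (Bool; true; false; _∧_; if_then_else_)
open import Data.Fin using (Fin)
open import Data.List using (List; []; _∷_; foldr; map)
open import Data.Nat.ListAction using (sum)
open import Data.Bool.ListAction using (any)
open import Data.List.Base using (allFin)
open import Data.Maybe using (Maybe; just; nothing)
open import Data.Sum using (_⊎_)
open import Data.Product using (∃; _×_)
open import Relation.Binary.PropositionalEquality using (_≡_; _≢_)

Graph : ℕ → Set
Graph n = Fin n → Fin n → Bool

-- simple: no loops (anti-parallel edges allowed)
Loopless : ∀ {n} → Graph n → Set
Loopless {n} E = (v : Fin n) → E v v ≡ false

UnderlyingDiam1 : ∀ {n} → Graph n → Set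
UnderlyingDiam1 {n} E = (u v : Fin n) → u ≢ v → E u v ≡ true ⊎ E v u ≡ true

dout : ∀ {n} → Graph n → Fin n → ℕ
dout {n} E u = sum (map (λ v → if E u v then 1 else 0) (allFin n))

maxM : Maybe ℕ → ℕ → Maybe ℕ
maxM nothing  a = just a
maxM (just b) a = just (b ⊔ a)

inA : ∀ {n} → Graph n → ℕ → Fin n → Bool
inA {n} E i u = (i <ᵇ dout E u) ∧ any (λ w → E w u ∧ (dout E w ≤ᵇ i)) (allFin n)

M : ∀ {n} → Graph n → ℕ → Maybe ℕ
M {n} E i = foldr (λ u acc → if inA E i u then maxM acc (dout E u) else acc) nothing (allFin n)

f : ∀ {n} → Graph n → ℕ → Fin n → Maybe ℕ
f {n} E zero x =
  just (foldr (λ v acc → if E x v then acc ⊔ dout E v else acc) (dout E x) (allFin n))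
f E (suc k) x with f E k x
... | nothing = nothing
... | just m  = M E m

data Walk {n} (E : Graph n) : Fin n → Fin n → ℕ → Set where
  here : ∀ {x} → Walk E x x 0
  step : ∀ {x z y L} → E x z ≡ true → Walk E z y L → Walk E x y (suc L)

Reachable : ∀ {n} → Graph n → Fin n → Fin n → Set
Reachable E x y = ∃ λ L → Walk E x y L

Good : ∀ {n} → Graph n → Fin n → Fin n → ℕ → Set
Good E x y i = ∃ λ m → f E i x ≡ just m × dout E y ≤ m

module Submission where

-- Call an index j "good for z" when f_j[x] ≠ ⊥ and
-- f_j[x] ≥ d_out(z) (this is the predicate Good E x z j).  Every out-neighbour
-- v of x is good at index 0, since f_0[x] is a maximum over N_out(x).  Goodness
-- propagates along edges at the cost of at most one index: if j is good for z
-- with value m and (z,z') is an edge, then either d_out(z') ≤ m, so j is good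
-- for z', or z' ∈ A(m), so M(m) = f_{j+1}[x] ≥ d_out(z').  Hence a walk of
-- length L from x to y ≠ x makes some j ≤ L - 1 good for y, which gives both
-- the existence part and, against the minimal good index i, the bound i+1 ≤ L.
-- Finally, j < n for every good j: out-degrees are < n in a loopless graph and
-- M(i) > i, so f_j[x] ≥ j and f_j[x] < n.

open import Defs
open import Data.Nat using (ℕ; zero; suc; _+_; _⊔_; _≤_; _<_; _≤ᵇ_; z≤n; s≤s)
open import Data.Nat.Properties
  using (≤-refl; ≤-trans; ≤-reflexive; <-≤-trans; ≤-<-trans; m≤n⇒m≤1+n; n≤1+n;
         m≤m+n; +-suc; +-monoˡ-≤; m≤m⊔n; m≤n⊔m; ⊔-lub; ⊔-sel; _≤?_; ≰⇒>;
         <ᵇ⇒<; <⇒<ᵇ; ≤⇒≤ᵇ)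
open import Data.Fin using (Fin)
open import Data.Bool using (Bool; true; false; _∧_; if_then_else_)
open import Data.Bool.Properties using (T-≡; T-∧)
open import Data.List using (List; []; _∷_; foldr; map; length; allFin)
open import Data.List.Properties using (length-tabulate)
open import Data.List.Relation.Unary.Any using (here; there)
open import Data.List.Relation.Unary.Any.Properties using (any⁺)
open import Data.List.Membership.Propositional using (_∈_; lose)
open import Data.List.Membership.Propositional.Properties using (∈-allFin)
open import Data.Nat.ListAction using (sum)
open import Data.Maybe using (Maybe; just; nothing)
open import Data.Maybe.Properties using (just-injective)
open import Data.Product using (_×_; Σ; _,_; proj₁)
open import Data.Sum using (inj₁; inj₂)
open import Data.Empty using (⊥-elim)
open import Function.Bundles using (Equivalence)
open import Relation.Nullary using (¬_; yes; no)
open import Relation.Binary.PropositionalEquality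
  using (_≡_; _≢_; refl; sym; trans)

private
  variable
    A : Set

count-≤ : (h : A → Bool) (l : List A) →
  sum (map (λ v → if h v then 1 else 0) l) ≤ length l
count-≤ h [] = ≤-refl
count-≤ h (u ∷ l) with h u
... | true  = s≤s (count-≤ h l)
... | false = m≤n⇒m≤1+n (count-≤ h l)

count-< : (h : A → Bool) {v : A} (l : List A) → v ∈ l → h v ≡ false →
  sum (map (λ v → if h v then 1 else 0) l) < length l
count-< h (u ∷ l) (here refl) hv≡false rewrite hv≡false = s≤s (count-≤ h l)
count-< h (u ∷ l) (there v∈l) hv≡false with h u
... | true  = s≤s (count-< h l v∈l hv≡false)
... | false = m≤n⇒m≤1+n (count-< h l v∈l hv≡false)

-- Maximum of b and of the g-values of the p-selected elements of l; this is
-- the shape of f_0[x] (with b = d_out(x) and p = "is an out-neighbour of x").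
selMax : (A → Bool) → (A → ℕ) → ℕ → List A → ℕ
selMax p g b l = foldr (λ v acc → if p v then acc ⊔ g v else acc) b l

selMax-ub : (p : A → Bool) (g : A → ℕ) (b : ℕ) {v : A} (l : List A) →
  v ∈ l → p v ≡ true → g v ≤ selMax p g b l
selMax-ub p g b (u ∷ l) (here refl) pv≡true rewrite pv≡true =
  m≤n⊔m (selMax p g b l) (g u)
selMax-ub p g b (u ∷ l) (there v∈l) pv≡true with p u
... | true  = ≤-trans (selMax-ub p g b l v∈l pv≡true) (m≤m⊔n (selMax p g b l) (g u))
... | false = selMax-ub p g b l v∈l pv≡true

selMax-< : (p : A → Bool) (g : A → ℕ) {b k : ℕ} (l : List A) →
  b < k → (∀ v → g v < k) → selMax p g b l < k
selMax-< p g [] b<k g<k = b<k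
selMax-< p g (u ∷ l) b<k g<k with p u
... | true  = ⊔-lub (selMax-< p g l b<k g<k) (g<k u)
... | false = selMax-< p g l b<k g<k

-- Maximum of the g-values of the p-selected elements of l, ⊥ if there are
-- none; M(i) is selMaxM (inA E i) (dout E) over all vertices.
selMaxM : (A → Bool) → (A → ℕ) → List A → Maybe ℕ
selMaxM p g l = foldr (λ u acc → if p u then maxM acc (g u) else acc) nothing l

selMaxM-ub : (p : A → Bool) (g : A → ℕ) {v : A} (l : List A) →
  v ∈ l → p v ≡ true → Σ ℕ λ m → selMaxM p g l ≡ just m × g v ≤ m
selMaxM-ub p g {v} (u ∷ l) (here refl) pv≡true rewrite pv≡true
  with selMaxM p g l
... | nothing = g v , refl , ≤-refl
... | just b  = b ⊔ g v , refl , m≤n⊔m b (g v)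
selMaxM-ub p g (u ∷ l) (there v∈l) pv≡true
  with selMaxM-ub p g l v∈l pv≡true | p u
... | m , eq , gv≤m | false = m , eq , gv≤m
... | m , eq , gv≤m | true rewrite eq = m ⊔ g u , refl , ≤-trans gv≤m (m≤m⊔n m (g u))

selMaxM-attained : (p : A → Bool) (g : A → ℕ) (l : List A) {m : ℕ} →
  selMaxM p g l ≡ just m → Σ A λ v → p v ≡ true × g v ≡ m
selMaxM-attained p g (u ∷ l) eq with p u in pu
... | false = selMaxM-attained p g l eq
... | true with selMaxM p g l in rest
...   | nothing = u , pu , just-injective eq
...   | just b with ⊔-sel b (g u) | selMaxM-attained p g l rest
...     | inj₁ max≡b | v , pv , gv≡b = v , pv , trans gv≡b (trans (sym max≡b) (just-injective eq))
...     | inj₂ max≡g | _            = u , pu , trans (sym max≡g) (just-injective eq)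

module _ {n : ℕ} (E : Graph n) where

  -- In a loopless graph a vertex is not its own out-neighbour, so d_out < n.
  dout<n : Loopless E → (u : Fin n) → dout E u < n
  dout<n loopless u =
    <-≤-trans (count-< (E u) (allFin n) (∈-allFin u) (loopless u))
              (≤-reflexive (length-tabulate (λ v → v)))

  inA-intro : {i : ℕ} {w u : Fin n} → E w u ≡ true → dout E w ≤ i →
    i < dout E u → inA E i u ≡ true
  inA-intro {i} {w} {u} ewu dw≤i i<du = Equivalence.to T-≡
    (Equivalence.from T-∧
      ( <⇒<ᵇ i<du
      , any⁺ (λ w′ → E w′ u ∧ (dout E w′ ≤ᵇ i))
             (lose (∈-allFin w) (Equivalence.from T-∧
                (Equivalence.from T-≡ ewu , ≤⇒≤ᵇ dw≤i)))))

  inA⇒< : {i : ℕ} {u : Fin n} → inA E i u ≡ true → i < dout E u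
  inA⇒< {i} {u} u∈A =
    <ᵇ⇒< i (dout E u) (proj₁ (Equivalence.to T-∧ (Equivalence.from T-≡ u∈A)))

  -- A defined M(i) exceeds i and, being an out-degree, is below n.
  M-bounds : Loopless E → {i m : ℕ} → M E i ≡ just m → i < m × m < n
  M-bounds loopless {i} eq with selMaxM-attained (inA E i) (dout E) (allFin n) eq
  ... | u , u∈A , du≡m rewrite sym du≡m = inA⇒< u∈A , dout<n loopless u

  M-ub : {i : ℕ} {u : Fin n} → inA E i u ≡ true →
    Σ ℕ λ m → M E i ≡ just m × dout E u ≤ m
  M-ub {i} {u} u∈A = selMaxM-ub (inA E i) (dout E) (allFin n) (∈-allFin u) u∈A

  module _ (x : Fin n) where

    f-suc : {j m : ℕ} → f E j x ≡ just m → f E (suc j) x ≡ M E m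
    f-suc {j} eq with f E j x
    f-suc refl | just _ = refl

    -- Defined values satisfy j ≤ f_j[x] < n, since M strictly increases.
    f-bounds : Loopless E → (j : ℕ) {m : ℕ} → f E j x ≡ just m → j ≤ m × m < n
    f-bounds loopless zero refl =
      z≤n , selMax-< (E x) (dout E) (allFin n) (dout<n loopless x) (dout<n loopless)
    f-bounds loopless (suc j) eq with f E j x in prev
    ... | just k with f-bounds loopless j prev | M-bounds loopless eq
    ...   | j≤k , _ | k<m , m<n = <-≤-trans (s≤s j≤k) k<m , m<n

    good⇒<n : Loopless E → {y : Fin n} {j : ℕ} → Good E x y j → j < n
    good⇒<n loopless (m , eq , _) with f-bounds loopless _ eq
    ... | j≤m , m<n = ≤-<-trans j≤m m<n

    good-start : {v : Fin n} → E x v ≡ true → Good E x v 0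
    good-start {v} exv = _ , refl , selMax-ub (E x) (dout E) (dout E x) (allFin n) (∈-allFin v) exv

    good-step : {z z′ : Fin n} {j : ℕ} → Good E x z j → E z z′ ≡ true →
      Σ ℕ λ j′ → j′ ≤ suc j × Good E x z′ j′
    good-step {z′ = z′} {j} (m , eq , dz≤m) ezz′ with dout E z′ ≤? m
    ... | yes dz′≤m = j , n≤1+n j , m , eq , dz′≤m
    ... | no  dz′≰m with M-ub (inA-intro ezz′ dz≤m (≰⇒> dz′≰m))
    ...   | m′ , eqM , dz′≤m′ = suc j , ≤-refl , m′ , trans (f-suc {j} eq) eqM , dz′≤m′

    good-walk : {z y : Fin n} {j L : ℕ} → Good E x z j → Walk E z y L →
      Σ ℕ λ j′ → j′ ≤ j + L × Good E x y j′
    good-walk {j = j} good here = j , m≤m+n j 0 , good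
    good-walk {j = j} good (step {L = L} e walk) with good-step good e
    ... | j₁ , j₁≤1+j , good₁ with good-walk good₁ walk
    ...   | j′ , j′≤j₁+L , good′ =
      j′ , ≤-trans j′≤j₁+L (≤-trans (+-monoˡ-≤ L j₁≤1+j) (≤-reflexive (sym (+-suc j L))))
         , good′

    good-before-arrival : {y : Fin n} {L : ℕ} → x ≢ y → Walk E x y L →
      Σ ℕ λ j → suc j ≤ L × Good E x y j
    good-before-arrival x≢y here = ⊥-elim (x≢y refl)
    good-before-arrival x≢y (step e walk) with good-walk (good-start e) walk
    ... | j , j≤L , good = j , s≤s j≤L , good

lemma5 : (n : ℕ) (E : Graph n) → Loopless E → UnderlyingDiam1 E →
    (x y : Fin n) → x ≢ y → Reachable E x y →
    Σ ℕ (λ i → i < n × Good E x y i)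
    × ((i : ℕ) → i < n → Good E x y i → ((j : ℕ) → j < i → ¬ Good E x y j) →
        (L : ℕ) → Walk E x y L → suc i ≤ L)
lemma5 n E loopless _ x y x≢y (_ , walk) = existence , minimality
  where
  existence : Σ ℕ (λ i → i < n × Good E x y i)
  existence with good-before-arrival E x x≢y walk
  ... | j , _ , good = j , good⇒<n E x loopless good , good

  minimality : (i : ℕ) → i < n → Good E x y i → ((j : ℕ) → j < i → ¬ Good E x y j) →
    (L : ℕ) → Walk E x y L → suc i ≤ L
  minimality i _ _ noEarlier L walk′ with good-before-arrival E x x≢y walk′
  ... | j , j<L , good with i ≤? j
  ...   | yes i≤j = ≤-trans (s≤s i≤j) j<L
  ...   | no  i≰j = ⊥-elim (noEarlier j (≰⇒> i≰j) good)
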